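{- Let $L$ be a finite lattice, $\tilde L$ as in the context, and $$\mathcal{S}=\{\overline{T}|_L\mid T \text{ is a t-norm on } C(\tilde L) \text{ satisfying condition (C)}\}.$$ Then $\mathcal{S}$ is contained in the set of t-norms on $L$, and $(\mathcal{S},\le)$, ordered pointwise ($T_1\le T_2$ iff $T_1(x,y)\le T_2(x,y)$ for all $x,y\in L$), is a lattice.
   Context: For a lattice $L$ with bottom $0$ and top $1$: an atom is an element covering $0$; $A(L)$ is the set of atoms; $J(L)$ the set of non-zero join-irreducible elements; $H(L)=J(L)\setminus A(L)$. $\tilde L$ is obtained from the finite lattice $L$ by adding, for each $p\in H(L)$, a new distinct element $w_p$ with $0\prec w_p\prec p$ (so $w_p\le x$ for $x\in L$ iff $p\le x$); $\tilde L$ is a finite atomistic lattice containing $L$ as a sublattice with the same $0$ and $1$, with $A(\tilde L)=A(L)\cup\{w_p\mid p\in H(L)\}$. $A_{\tilde L}(x)=\{a\in A(\tilde L)\mid a\le x\}$; $C(\tilde L)=A(\tilde L)\cup\{0,1\}$ with the inherited order. A t-norm on a bounded poset with top $1$ is a binary operation that is monotone in each argument, commutative, associative, with neutral element $1$. For a t-norm $T$ on $C(\tilde L)$, $\overline{T}(x,y)=\bigvee_{u\in\kappa(x)}\bigvee_{v\in\kappa(y)}T(u,v)$ for $x,y\in\tilde L$, where $\kappa(x)=\{u\in C(\tilde L)\setminus\{0\}\mid u\le x\}$, and $\overline T|_L$ is its restriction to $L\times L$. Condition (C) for $T$: for every $p\in H(L)\setminus\{1\}$, if $T(w_p,w_p)\ne0$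 then there exists $u\in A_{\tilde L}(p)\setminus\{w_p\}$ with $T(u,u)\ne0$. -}

module Defs where

open import Level using (0ℓ)
open import Data.Nat using (ℕ)
open import Data.Fin using (Fin)
open import Data.Fin.Properties using (all?; _≟_)
open import Data.Product using (Σ; Σ-syntax; ∃; _×_; _,_; proj₁; proj₂)
open import Data.Sum using (_⊎_; inj₁; inj₂)
open import Data.Unit using (⊤)
open import Relation.Nullary using (¬_; Dec; yes; no)
open import Relation.Nullary.Decidable using (True; fromWitness; ¬?; _×-dec_; _⊎-dec_; _→-dec_)
open import Relation.Binary using (Rel; Decidable)
open import Relation.Binary.PropositionalEquality using (_≡_; _≢_; refl; sym; trans; subst; cong)
open import Relation.Binary.Lattice using (IsBoundedLattice)
open import Algebra.Core using (Op₂)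

-- A finite lattice with 0 and 1, presented on the carrier Fin n
-- (every finite lattice is isomorphic to one of this form).

record FinLattice (n : ℕ) : Set₁ where
  field
    _≤_ : Rel (Fin n) 0ℓ
    _∨_ : Op₂ (Fin n)
    _∧_ : Op₂ (Fin n)
    𝟙   : Fin n
    𝟘   : Fin n
    isBoundedLattice : IsBoundedLattice _≡_ _≤_ _∨_ _∧_ 𝟙 𝟘

  open IsBoundedLattice isBoundedLattice public
    using (antisym; reflexive; x≤x∨y; y≤x∨y; ∨-least)

  _≤?_ : Decidable _≤_
  x ≤? y with (x ∨ y) ≟ y
  ... | yes e = yes (subst (x ≤_) e (x≤x∨y x y))
  ... | no ne = no λ x≤y → ne (antisym (∨-least x≤y (reflexive refl)) (y≤x∨y x y))

  IsAtom : Fin n → Set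
  IsAtom a = (a ≢ 𝟘) × (∀ x → x ≤ a → (x ≡ 𝟘) ⊎ (x ≡ a))

  isAtom? : (a : Fin n) → Dec (IsAtom a)
  isAtom? a = ¬? (a ≟ 𝟘) ×-dec all? (λ x → (x ≤? a) →-dec ((x ≟ 𝟘) ⊎-dec (x ≟ a)))

  IsJoinIrr : Fin n → Set
  IsJoinIrr p = (p ≢ 𝟘) × (∀ x y → x ∨ y ≡ p → (x ≡ p) ⊎ (y ≡ p))

  isJoinIrr? : (p : Fin n) → Dec (IsJoinIrr p)
  isJoinIrr? p = ¬? (p ≟ 𝟘) ×-dec
    all? (λ x → all? (λ y → ((x ∨ y) ≟ p) →-dec ((x ≟ p) ⊎-dec (y ≟ p))))

  IsH : Fin n → Set
  IsH p = IsJoinIrr p × ¬ IsAtom p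

  isH? : (p : Fin n) → Dec (IsH p)
  isH? p = isJoinIrr? p ×-dec ¬? (isAtom? p)

  -- The lattice L̃ : L together with one new element w_p for each p ∈ H(L)

  W : Set
  W = Σ (Fin n) (λ p → True (isH? p))

  L̃ : Set
  L̃ = Fin n ⊎ W

  emb : Fin n → L̃
  emb = inj₁

  w : (p : Fin n) → True (isH? p) → L̃
  w p h = inj₂ (p , h)

  𝟘̃ 𝟙̃ : L̃
  𝟘̃ = inj₁ 𝟘
  𝟙̃ = inj₁ 𝟙

  -- order of L̃:  0 ≺ w_p ≺ p,  w_p ≤ x (x ∈ L) iff p ≤ x
  _≤̃_ : L̃ → L̃ → Set
  inj₁ x       ≤̃ inj₁ y       = x ≤ y
  inj₁ x       ≤̃ inj₂ _       = x ≡ 𝟘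
  inj₂ (p , _) ≤̃ inj₁ y       = p ≤ y
  inj₂ (p , _) ≤̃ inj₂ (q , _) = p ≡ q

  IsAtomL̃ : L̃ → Set
  IsAtomL̃ (inj₁ a) = IsAtom a
  IsAtomL̃ (inj₂ _) = ⊤

  InC : L̃ → Set
  InC x = (x ≡ 𝟘̃) ⊎ (x ≡ 𝟙̃) ⊎ IsAtomL̃ x

  inC? : (x : L̃) → Dec (InC x)
  inC? (inj₁ x) with x ≟ 𝟘 | x ≟ 𝟙 | isAtom? x
  ... | yes e | _ | _ = yes (inj₁ (cong inj₁ e))
  ... | no _  | yes e | _ = yes (inj₂ (inj₁ (cong inj₁ e)))
  ... | no _  | no _ | yes a = yes (inj₂ (inj₂ a))
  ... | no n0 | no n1 | no na = no λ
    { (inj₁ refl) → n0 refl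
    ; (inj₂ (inj₁ refl)) → n1 refl
    ; (inj₂ (inj₂ a)) → na a }
  inC? (inj₂ h) = yes (inj₂ (inj₂ _))

  C : Set
  C = Σ L̃ (λ x → True (inC? x))

  _≤C_ : C → C → Set
  u ≤C v = proj₁ u ≤̃ proj₁ v

  𝟙C : C
  𝟙C = 𝟙̃ , fromWitness {a? = inC? 𝟙̃} (inj₂ (inj₁ refl))

  CondC : (C → C → C) → Set
  CondC T = (p : Fin n) (h : True (isH? p)) → p ≢ 𝟙 →
    let wp = w p h
        wpC : C
        wpC = wp , fromWitness {a? = inC? wp} (inj₂ (inj₂ _))
    in proj₁ (T wpC wpC) ≢ 𝟘̃ →
       Σ[ u ∈ C ] (IsAtomL̃ (proj₁ u) × proj₁ u ≤̃ emb p × proj₁ u ≢ wp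
                   × proj₁ (T u u) ≢ 𝟘̃)

  -- T̄ restricted to L:  z ∈ L̃ is the join in L̃ of
  --   { T(u,v) | u ∈ κ(x), v ∈ κ(y) },  κ(x) = { u ∈ C(L̃)∖{0} | u ≤ x }

  InKappa : L̃ → C → Set
  InKappa x u = (proj₁ u ≢ 𝟘̃) × (proj₁ u ≤̃ x)

  IsBarValue : (C → C → C) → L̃ → L̃ → L̃ → Set
  IsBarValue T x y z =
    (∀ u v → InKappa x u → InKappa y v → proj₁ (T u v) ≤̃ z)
    × (∀ z′ → (∀ u v → InKappa x u → InKappa y v → proj₁ (T u v) ≤̃ z′) → z ≤̃ z′)

  RestrictsTo : (C → C → C) → (Fin n → Fin n → Fin n) → Set
  RestrictsTo T f = ∀ x y → IsBarValue T (emb x) (emb y) (emb (f x y))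

record IsTNorm {A : Set} (_≼_ : A → A → Set) (top : A) (T : A → A → A) : Set where
  field
    mono  : ∀ {x x′ y y′} → x ≼ x′ → y ≼ y′ → T x y ≼ T x′ y′
    comm  : ∀ x y → T x y ≡ T y x
    assoc : ∀ x y z → T (T x y) z ≡ T x (T y z)
    identityʳ : ∀ x → T x top ≡ x

module _ {n : ℕ} (L : FinLattice n) where
  open FinLattice L

  IsTNormC : (C → C → C) → Set
  IsTNormC = IsTNorm _≤C_ 𝟙C

  IsTNormL : (Fin n → Fin n → Fin n) → Set
  IsTNormL = IsTNorm _≤_ 𝟙

  InS : (Fin n → Fin n → Fin n) → Set
  InS f = Σ[ T ∈ (C → C → C) ] (IsTNormC T × CondC T × RestrictsTo T f)

  _≤̇_ : (Fin n → Fin n → Fin n) → (Fin n → Fin n → Fin n) → Set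
  f ≤̇ g = ∀ x y → f x y ≤ g x y

  IsJoinInS : (f g h : Fin n → Fin n → Fin n) → Set
  IsJoinInS f g h = InS h × f ≤̇ h × g ≤̇ h
    × (∀ k → InS k → f ≤̇ k → g ≤̇ k → h ≤̇ k)

  IsMeetInS : (f g h : Fin n → Fin n → Fin n) → Set
  IsMeetInS f g h = InS h × h ≤̇ f × h ≤̇ g
    × (∀ k → InS k → k ≤̇ f → k ≤̇ g → k ≤̇ h)

{-# OPTIONS --safe #-}
module Submission where

-- Below 1, C(L̃) consists of 0 and pairwise incomparable atoms, so a t-norm T on C(L̃) is
-- determined by its idempotent atoms: T(u,v) = 0 unless u = v, and T(u,u) ∈ {0, u}.
-- The atoms of L̃ correspond to the join-irreducibles of L, and L is atomistic inside L̃;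
-- hence for x, y ≠ 1 the join T̄(x,y) is computed from the idempotent atoms below x ∧ y, and
-- condition (C) rules out the one bad case, a lone idempotent w_p, whose join would leave L.
-- So T̄|_L(x,y) = ⋁{a ∈ G_T | a ≤ x ∧ y}, where G_T is the set of join-irreducibles with
-- idempotent atom, and any such formula (with unit 1) is a t-norm on L.  Comparing members
-- of 𝒮 reduces to comparing generators, and every set of atoms satisfying (C) is the set
-- of idempotents of some t-norm on C(L̃).  The join in 𝒮 is generated by G_T₁ ∪ G_T₂; the
-- meet by the a with f(a,a) = g(a,a) = a, keeping w_p only when such an atom of L lies
-- below p, which is possible by iterating (C).

open import Defs
open import Level using (0ℓ)
open import Data.Nat using (ℕ; zero; suc)
open import Data.Fin using (Fin; zero; suc)
open import Data.Fin.Properties using (_≟_; ¬∀⟶∃¬; all?; any?)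
open import Data.Fin.Induction using (po-wellFounded)
open import Data.Product using (Σ; Σ-syntax; ∃; ∃₂; _×_; _,_; proj₁; proj₂)
open import Data.Sum as Sum using (_⊎_; inj₁; inj₂)
open import Data.Empty using (⊥; ⊥-elim)
open import Data.Unit using (tt)
open import Data.Bool.Properties using (T-irrelevant)
open import Data.Sum.Properties using () renaming (≡-dec to ⊎-≡-dec)
open import Data.Product.Properties using () renaming (≡-dec to Σ-≡-dec)
open import Function using (_∘_)
open import Induction.WellFounded using (WellFounded; WfRec; module All)
open import Relation.Nullary using (¬_; Dec; yes; no; contradiction; ¬?)
open import Relation.Nullary.Decidable using (True; fromWitness; toWitness; map′; T?; _×-dec_; _⊎-dec_; _→-dec_)
open import Relation.Unary using (Pred; Decidable)
open import Relation.Binary.PropositionalEquality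
  using (_≡_; _≢_; refl; sym; trans; subst; subst₂; cong; cong₂; module ≡-Reasoning)
open import Relation.Binary.Definitions using (DecidableEquality)
open import Relation.Binary.Lattice using (IsBoundedLattice; Lattice)
import Relation.Binary.Construct.NonStrictToStrict as NonStrictToStrict
import Relation.Binary.Lattice.Properties.MeetSemilattice as MeetSemilatticeProperties
import Relation.Binary.Reasoning.PartialOrder as PartialOrderReasoning

Σ-dec : ∀ {a b} {A : Set a} {B : A → Set b} →
        Dec A → (∀ {x y} → B x → B y) → (∀ x → Dec (B x)) → Dec (Σ A B)
Σ-dec (yes x) B-const B? = map′ (x ,_) (λ (_ , b) → B-const b) (B? x)
Σ-dec (no ¬x) _       _  = no (¬x ∘ proj₁)

counterexample-→ : ∀ {A B : Set} → Dec A → ¬ (A → B) → A × ¬ B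
counterexample-→ (yes a) ¬f = a , λ b → ¬f λ _ → b
counterexample-→ (no ¬a) ¬f = ⊥-elim (¬f λ a → contradiction a ¬a)

module _ {n : ℕ} (L : FinLattice n) where
  open FinLattice L
  open IsBoundedLattice isBoundedLattice
    using (isLattice; isPartialOrder; x∧y≤x; x∧y≤y; ∧-greatest; maximum; minimum)
    renaming (refl to ≤-refl; trans to ≤-trans)
  lattice : Lattice _ _ _
  lattice = record { isLattice = isLattice }

  open MeetSemilatticeProperties (Lattice.meetSemilattice lattice) using (∧-comm; ∧-assoc; ∧-monotonic)
  module ≤-Reasoning = PartialOrderReasoning (Lattice.poset lattice)
  open NonStrictToStrict _≡_ _≤_ using (_<_)
  <-wellFounded : WellFounded _<_
  <-wellFounded = po-wellFounded isPartialOrder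

  ≤𝟘⇒≡𝟘 : ∀ {x} → x ≤ 𝟘 → x ≡ 𝟘
  ≤𝟘⇒≡𝟘 x≤𝟘 = antisym x≤𝟘 (minimum _)

  ≤-≢𝟙 : ∀ {x y} → x ≤ y → y ≢ 𝟙 → x ≢ 𝟙
  ≤-≢𝟙 x≤y y≢𝟙 refl = y≢𝟙 (antisym (maximum _) x≤y)

  ⋁ᶠ : ∀ {m} → (Fin m → Fin n) → Fin n
  ⋁ᶠ {zero}  t = 𝟘
  ⋁ᶠ {suc m} t = t zero ∨ ⋁ᶠ (t ∘ suc)

  ⋁ᶠ-upper : ∀ {m} (t : Fin m → Fin n) i → t i ≤ ⋁ᶠ t
  ⋁ᶠ-upper t zero    = x≤x∨y _ _
  ⋁ᶠ-upper t (suc i) = ≤-trans (⋁ᶠ-upper (t ∘ suc) i) (y≤x∨y _ _)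

  ⋁ᶠ-least : ∀ {m} (t : Fin m → Fin n) {b} → (∀ i → t i ≤ b) → ⋁ᶠ t ≤ b
  ⋁ᶠ-least {zero}  t t≤b = minimum _
  ⋁ᶠ-least {suc m} t t≤b = ∨-least (t≤b zero) (⋁ᶠ-least (t ∘ suc) (t≤b ∘ suc))

  keepIf : ∀ {ℓ} {A : Set ℓ} → Fin n → Dec A → Fin n
  keepIf a (yes _) = a
  keepIf a (no _)  = 𝟘

  module _ {ℓ} {P : Pred (Fin n) ℓ} (P? : Decidable P) where

    ⋁[_] : Fin n
    ⋁[_] = ⋁ᶠ λ a → keepIf a (P? a)

    ≤-⋁ : ∀ {a} → P a → a ≤ ⋁[_]
    ≤-⋁ {a} pa = ≤-trans (kept (P? a)) (⋁ᶠ-upper _ a)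
      where
      kept : (d : Dec (P a)) → a ≤ keepIf a d
      kept (yes _)  = ≤-refl
      kept (no ¬pa) = contradiction pa ¬pa

    ⋁-least : ∀ {b} → (∀ a → P a → a ≤ b) → ⋁[_] ≤ b
    ⋁-least {b} P≤b = ⋁ᶠ-least _ λ a → kept a (P? a)
      where
      kept : ∀ a (d : Dec (P a)) → keepIf a d ≤ b
      kept a (yes pa) = P≤b a pa
      kept a (no _)   = minimum b

  nonJoinIrr-split : ∀ {y} → y ≢ 𝟘 → ¬ IsJoinIrr y →
                     ∃₂ λ a b → (a ∨ b) ≡ y × a ≢ y × b ≢ y
  nonJoinIrr-split {y} y≢𝟘 ¬jy =
    let a , ¬∀b = ¬∀⟶∃¬ n _ splits? λ ∀a → ¬jy (y≢𝟘 , ∀a)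
        b , ¬split = ¬∀⟶∃¬ n _ (splits-at? a) ¬∀b
        a∨b≡y , ¬a≡y⊎b≡y = counterexample-→ ((a ∨ b) ≟ y) ¬split
    in a , b , a∨b≡y , ¬a≡y⊎b≡y ∘ inj₁ , ¬a≡y⊎b≡y ∘ inj₂
    where
    splits-at? : ∀ a b → Dec ((a ∨ b) ≡ y → (a ≡ y) ⊎ (b ≡ y))
    splits-at? a b = ((a ∨ b) ≟ y) →-dec ((a ≟ y) ⊎-dec (b ≟ y))
    splits? : ∀ a → Dec (∀ b → (a ∨ b) ≡ y → (a ≡ y) ⊎ (b ≡ y))
    splits? a = all? (splits-at? a)

  nonAtom-strictlyBelow : ∀ {q} → q ≢ 𝟘 → ¬ IsAtom q → ∃ λ x → x ≤ q × x ≢ 𝟘 × x ≢ q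
  nonAtom-strictlyBelow {q} q≢𝟘 ¬aq =
    let x , ¬minimal = ¬∀⟶∃¬ n _ (λ x → (x ≤? q) →-dec ((x ≟ 𝟘) ⊎-dec (x ≟ q))) λ ∀x → ¬aq (q≢𝟘 , ∀x)
        x≤q , ¬x≡𝟘⊎x≡q = counterexample-→ (x ≤? q) ¬minimal
    in x , x≤q , ¬x≡𝟘⊎x≡q ∘ inj₁ , ¬x≡𝟘⊎x≡q ∘ inj₂

  ≤-byJoinIrr : ∀ y z → (∀ p → IsJoinIrr p → p ≤ y → p ≤ z) → y ≤ z
  ≤-byJoinIrr = All.wfRec <-wellFounded _ BoundedByJoinIrr step
    where
    BoundedByJoinIrr : Fin n → Set
    BoundedByJoinIrr y = ∀ z → (∀ p → IsJoinIrr p → p ≤ y → p ≤ z) → y ≤ z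
    step : ∀ y → WfRec _<_ BoundedByJoinIrr y → BoundedByJoinIrr y
    step y rec z JI≤z with y ≟ 𝟘 | isJoinIrr? y
    ... | yes refl | _      = minimum z
    ... | no _     | yes jy = JI≤z y jy ≤-refl
    ... | no y≢𝟘   | no ¬jy with nonJoinIrr-split y≢𝟘 ¬jy
    ... | a , b , refl , a≢y , b≢y = ∨-least (part (x≤x∨y a b) a≢y) (part (y≤x∨y a b) b≢y)
      where
      part : ∀ {c} → c ≤ (a ∨ b) → c ≢ (a ∨ b) → c ≤ z
      part c≤y c≢y = rec (c≤y , c≢y) z λ p jp p≤c → JI≤z p jp (≤-trans p≤c c≤y)

  -- q has some 0 < x < q, and no join-irreducible below x can equal q.
  joinIrrs-≡-nonAtom⇒≤𝟘 : ∀ {q y} → q ≢ 𝟘 → ¬ IsAtom q → (∀ p → IsJoinIrr p → p ≤ y → p ≡ q) → y ≤ 𝟘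
  joinIrrs-≡-nonAtom⇒≤𝟘 {q} {y} q≢𝟘 ¬aq only = ≤-byJoinIrr y 𝟘 λ p jp p≤y →
    let q≤y = subst (_≤ y) (only p jp p≤y) p≤y
        x , x≤q , x≢𝟘 , x≢q = nonAtom-strictlyBelow q≢𝟘 ¬aq
        x≤𝟘 = ≤-byJoinIrr x 𝟘 λ p′ jp′ p′≤x →
          let p′≡q = only p′ jp′ (≤-trans p′≤x (≤-trans x≤q q≤y))
          in contradiction (antisym x≤q (subst (_≤ x) p′≡q p′≤x)) x≢q
    in contradiction (≤𝟘⇒≡𝟘 x≤𝟘) x≢𝟘

  -- The t-norm on L generated by a set of elements

  module _ {ℓ} {G : Pred (Fin n) ℓ} (G? : Decidable G) where

    inG-below? : ∀ z → Decidable (λ a → G a × a ≤ z)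
    inG-below? z a = G? a ×-dec a ≤? z

    joinBelow : Fin n → Fin n
    joinBelow z = ⋁[ inG-below? z ]

    joinBelow-≤ : ∀ z → joinBelow z ≤ z
    joinBelow-≤ z = ⋁-least (inG-below? z) λ _ → proj₂

    ≤-joinBelow : ∀ {a z} → G a → a ≤ z → a ≤ joinBelow z
    ≤-joinBelow {z = z} ga a≤z = ≤-⋁ (inG-below? z) (ga , a≤z)

    joinBelow-least : ∀ {z b} → (∀ a → G a → a ≤ z → a ≤ b) → joinBelow z ≤ b
    joinBelow-least {z} G≤b = ⋁-least (inG-below? z) λ a (ga , a≤z) → G≤b a ga a≤z

    joinBelow-mono : ∀ {z z′} → z ≤ z′ → joinBelow z ≤ joinBelow z′
    joinBelow-mono z≤z′ = joinBelow-least λ a ga a≤z → ≤-joinBelow ga (≤-trans a≤z z≤z′)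

    joinBelow-squeeze : ∀ {z z′} → z′ ≤ z → joinBelow z ≤ z′ → joinBelow z′ ≡ joinBelow z
    joinBelow-squeeze z′≤z jz≤z′ = antisym (joinBelow-mono z′≤z)
      (joinBelow-least λ a ga a≤z → ≤-joinBelow ga (≤-trans (≤-joinBelow ga a≤z) jz≤z′))

    joinBelow-absorbˡ : ∀ u v → joinBelow (joinBelow u ∧ v) ≡ joinBelow (u ∧ v)
    joinBelow-absorbˡ u v = joinBelow-squeeze (∧-monotonic (joinBelow-≤ u) ≤-refl)
      (∧-greatest (joinBelow-mono (x∧y≤x u v)) (≤-trans (joinBelow-≤ _) (x∧y≤y u v)))

    joinBelow-absorbʳ : ∀ u v → joinBelow (u ∧ joinBelow v) ≡ joinBelow (u ∧ v)
    joinBelow-absorbʳ u v = joinBelow-squeeze (∧-monotonic ≤-refl (joinBelow-≤ v))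
      (∧-greatest (≤-trans (joinBelow-≤ _) (x∧y≤x u v)) (joinBelow-mono (x∧y≤y u v)))

    opaque
      tnormOf : Fin n → Fin n → Fin n
      tnormOf x y with x ≟ 𝟙 | y ≟ 𝟙
      ... | yes _ | _     = y
      ... | no _  | yes _ = x
      ... | no _  | no _  = joinBelow (x ∧ y)

      tnormOf-𝟙ˡ : ∀ y → tnormOf 𝟙 y ≡ y
      tnormOf-𝟙ˡ y with 𝟙 ≟ 𝟙
      ... | yes _   = refl
      ... | no 𝟙≢𝟙 = contradiction refl 𝟙≢𝟙

      tnormOf-𝟙ʳ : ∀ x → tnormOf x 𝟙 ≡ x
      tnormOf-𝟙ʳ x with x ≟ 𝟙 | 𝟙 ≟ 𝟙
      ... | yes refl | _       = refl
      ... | no _     | yes _   = refl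
      ... | no _     | no 𝟙≢𝟙 = contradiction refl 𝟙≢𝟙

      tnormOf-≢𝟙 : ∀ {x y} → x ≢ 𝟙 → y ≢ 𝟙 → tnormOf x y ≡ joinBelow (x ∧ y)
      tnormOf-≢𝟙 {x} {y} x≢𝟙 y≢𝟙 with x ≟ 𝟙 | y ≟ 𝟙
      ... | yes x≡𝟙 | _       = contradiction x≡𝟙 x≢𝟙
      ... | no _    | yes y≡𝟙 = contradiction y≡𝟙 y≢𝟙
      ... | no _    | no _    = refl

    tnormOf-comm : ∀ x y → tnormOf x y ≡ tnormOf y x
    tnormOf-comm x y with x ≟ 𝟙 | y ≟ 𝟙
    ... | yes refl | _        = trans (tnormOf-𝟙ˡ y) (sym (tnormOf-𝟙ʳ y))
    ... | no _     | yes refl = trans (tnormOf-𝟙ʳ x) (sym (tnormOf-𝟙ˡ x))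
    ... | no x≢𝟙   | no y≢𝟙  = begin
      tnormOf x y        ≡⟨ tnormOf-≢𝟙 x≢𝟙 y≢𝟙 ⟩
      joinBelow (x ∧ y)  ≡⟨ cong joinBelow (∧-comm x y) ⟩
      joinBelow (y ∧ x)  ≡⟨ tnormOf-≢𝟙 y≢𝟙 x≢𝟙 ⟨
      tnormOf y x        ∎
      where open ≡-Reasoning

    tnormOf-≤ʳ : ∀ x y → tnormOf x y ≤ y
    tnormOf-≤ʳ x y with x ≟ 𝟙 | y ≟ 𝟙
    ... | yes refl | _        = reflexive (tnormOf-𝟙ˡ y)
    ... | no _     | yes refl = maximum _
    ... | no x≢𝟙   | no y≢𝟙  =
      subst (_≤ y) (sym (tnormOf-≢𝟙 x≢𝟙 y≢𝟙)) (≤-trans (joinBelow-≤ _) (x∧y≤y x y))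

    tnormOf-≤ˡ : ∀ x y → tnormOf x y ≤ x
    tnormOf-≤ˡ x y = subst (_≤ x) (tnormOf-comm y x) (tnormOf-≤ʳ y x)

    tnormOf-mono : ∀ {x x′ y y′} → x ≤ x′ → y ≤ y′ → tnormOf x y ≤ tnormOf x′ y′
    tnormOf-mono {x} {x′} {y} {y′} x≤x′ y≤y′ with x′ ≟ 𝟙 | y′ ≟ 𝟙
    ... | yes refl | _        = subst (tnormOf x y ≤_) (sym (tnormOf-𝟙ˡ y′)) (≤-trans (tnormOf-≤ʳ x y) y≤y′)
    ... | no _     | yes refl = subst (tnormOf x y ≤_) (sym (tnormOf-𝟙ʳ x′)) (≤-trans (tnormOf-≤ˡ x y) x≤x′)
    ... | no x′≢𝟙  | no y′≢𝟙 = begin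
      tnormOf x y          ≡⟨ tnormOf-≢𝟙 (≤-≢𝟙 x≤x′ x′≢𝟙) (≤-≢𝟙 y≤y′ y′≢𝟙) ⟩
      joinBelow (x ∧ y)    ≤⟨ joinBelow-mono (∧-monotonic x≤x′ y≤y′) ⟩
      joinBelow (x′ ∧ y′)  ≡⟨ tnormOf-≢𝟙 x′≢𝟙 y′≢𝟙 ⟨
      tnormOf x′ y′        ∎
      where open ≤-Reasoning

    tnormOf-assoc : ∀ x y z → tnormOf (tnormOf x y) z ≡ tnormOf x (tnormOf y z)
    tnormOf-assoc x y z with x ≟ 𝟙 | y ≟ 𝟙 | z ≟ 𝟙
    ... | yes refl | _        | _        =
      trans (cong (λ t → tnormOf t z) (tnormOf-𝟙ˡ y)) (sym (tnormOf-𝟙ˡ _))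
    ... | no _     | yes refl | _        =
      trans (cong (λ t → tnormOf t z) (tnormOf-𝟙ʳ x)) (cong (tnormOf x) (sym (tnormOf-𝟙ˡ z)))
    ... | no _     | no _     | yes refl =
      trans (tnormOf-𝟙ʳ _) (cong (tnormOf x) (sym (tnormOf-𝟙ʳ y)))
    ... | no x≢𝟙   | no y≢𝟙  | no z≢𝟙  = begin
      tnormOf (tnormOf x y) z            ≡⟨ tnormOf-≢𝟙 (≤-≢𝟙 (tnormOf-≤ˡ x y) x≢𝟙) z≢𝟙 ⟩
      joinBelow (tnormOf x y ∧ z)        ≡⟨ cong (λ t → joinBelow (t ∧ z)) (tnormOf-≢𝟙 x≢𝟙 y≢𝟙) ⟩
      joinBelow (joinBelow (x ∧ y) ∧ z)  ≡⟨ joinBelow-absorbˡ (x ∧ y) z ⟩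
      joinBelow ((x ∧ y) ∧ z)            ≡⟨ cong joinBelow (∧-assoc x y z) ⟩
      joinBelow (x ∧ (y ∧ z))            ≡⟨ joinBelow-absorbʳ x (y ∧ z) ⟨
      joinBelow (x ∧ joinBelow (y ∧ z))  ≡⟨ cong (λ t → joinBelow (x ∧ t)) (tnormOf-≢𝟙 y≢𝟙 z≢𝟙) ⟨
      joinBelow (x ∧ tnormOf y z)        ≡⟨ tnormOf-≢𝟙 x≢𝟙 (≤-≢𝟙 (tnormOf-≤ʳ y z) z≢𝟙) ⟨
      tnormOf x (tnormOf y z)            ∎
      where open ≡-Reasoning

    tnormOf-isTNorm : IsTNormL L tnormOf
    tnormOf-isTNorm = record
      { mono = tnormOf-mono ; comm = tnormOf-comm ; assoc = tnormOf-assoc ; identityʳ = tnormOf-𝟙ʳ }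

    ≤-tnormOf-diag : ∀ {a} → G a → a ≢ 𝟙 → a ≤ tnormOf a a
    ≤-tnormOf-diag ga a≢𝟙 =
      subst (_ ≤_) (sym (tnormOf-≢𝟙 a≢𝟙 a≢𝟙)) (≤-joinBelow ga (∧-greatest ≤-refl ≤-refl))

  tnormOf-≤ : ∀ {ℓ ℓ′} {G : Pred (Fin n) ℓ} {G′ : Pred (Fin n) ℓ′} (G? : Decidable G) (G′? : Decidable G′) →
              (∀ a → a ≢ 𝟙 → G a → a ≤ tnormOf G′? a a) → ∀ x y → tnormOf G? x y ≤ tnormOf G′? x y
  tnormOf-≤ G? G′? G≤diag x y with x ≟ 𝟙 | y ≟ 𝟙
  ... | yes refl | _        = reflexive (trans (tnormOf-𝟙ˡ G? y) (sym (tnormOf-𝟙ˡ G′? y)))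
  ... | no _     | yes refl = reflexive (trans (tnormOf-𝟙ʳ G? x) (sym (tnormOf-𝟙ʳ G′? x)))
  ... | no x≢𝟙   | no y≢𝟙  = subst (_≤ tnormOf G′? x y) (sym (tnormOf-≢𝟙 G? x≢𝟙 y≢𝟙))
    (joinBelow-least G? λ a ga a≤x∧y →
      let a≤x = ≤-trans a≤x∧y (x∧y≤x x y)
          a≤y = ≤-trans a≤x∧y (x∧y≤y x y)
      in ≤-trans (G≤diag a (≤-≢𝟙 a≤x x≢𝟙) ga) (tnormOf-mono G′? a≤x a≤y))

  -- ⌈ c ⌉ is the least element of L above c.
  ⌈_⌉ : L̃ → Fin n
  ⌈ inj₁ x ⌉       = x
  ⌈ inj₂ (p , _) ⌉ = p

  ≤̃emb⇒⌈⌉≤ : ∀ c {z} → c ≤̃ emb z → ⌈ c ⌉ ≤ z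
  ≤̃emb⇒⌈⌉≤ (inj₁ _) c≤z = c≤z
  ≤̃emb⇒⌈⌉≤ (inj₂ _) c≤z = c≤z

  ⌈⌉≤⇒≤̃emb : ∀ c {z} → ⌈ c ⌉ ≤ z → c ≤̃ emb z
  ⌈⌉≤⇒≤̃emb (inj₁ _) c≤z = c≤z
  ⌈⌉≤⇒≤̃emb (inj₂ _) c≤z = c≤z

  H⇒≢𝟘 : ∀ {p} → True (isH? p) → p ≢ 𝟘
  H⇒≢𝟘 h = proj₁ (proj₁ (toWitness h))

  H⇒¬atom : ∀ {p} → True (isH? p) → ¬ IsAtom p
  H⇒¬atom h = proj₂ (toWitness h)

  w-≡ : ∀ {p q} {h : True (isH? p)} {h′ : True (isH? q)} → p ≡ q → w p h ≡ w q h′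
  w-≡ {p} refl = cong (w p) (T-irrelevant _ _)

  _≟̃_ : DecidableEquality L̃
  _≟̃_ = ⊎-≡-dec _≟_ (Σ-≡-dec _≟_ λ h h′ → yes (T-irrelevant h h′))

  ≤̃-refl : ∀ c → c ≤̃ c
  ≤̃-refl (inj₁ _) = ≤-refl
  ≤̃-refl (inj₂ _) = refl

  ≤̃-trans : ∀ c d e → c ≤̃ d → d ≤̃ e → c ≤̃ e
  ≤̃-trans (inj₁ _) (inj₁ _) (inj₁ _) c≤d d≤e = ≤-trans c≤d d≤e
  ≤̃-trans (inj₁ _) (inj₁ _) (inj₂ _) c≤d refl = ≤𝟘⇒≡𝟘 c≤d
  ≤̃-trans (inj₁ _) (inj₂ _) (inj₁ e) refl d≤e = minimum e
  ≤̃-trans (inj₁ _) (inj₂ _) (inj₂ _) c≡𝟘 d≡e = c≡𝟘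
  ≤̃-trans (inj₂ _) (inj₁ _) (inj₁ _) c≤d d≤e = ≤-trans c≤d d≤e
  ≤̃-trans (inj₂ (_ , h)) (inj₁ _) (inj₂ _) c≤d refl = contradiction (≤𝟘⇒≡𝟘 c≤d) (H⇒≢𝟘 h)
  ≤̃-trans (inj₂ _) (inj₂ _) (inj₁ _) refl d≤e = d≤e
  ≤̃-trans (inj₂ _) (inj₂ _) (inj₂ _) c≡d d≡e = trans c≡d d≡e

  𝟘̃-minimum : ∀ c → 𝟘̃ ≤̃ c
  𝟘̃-minimum (inj₁ x) = minimum x
  𝟘̃-minimum (inj₂ _) = refl

  𝟙̃-maximum : ∀ c → c ≤̃ 𝟙̃
  𝟙̃-maximum c = ⌈⌉≤⇒≤̃emb c (maximum ⌈ c ⌉)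

  ≤̃𝟘̃⇒≡𝟘̃ : ∀ c → c ≤̃ 𝟘̃ → c ≡ 𝟘̃
  ≤̃𝟘̃⇒≡𝟘̃ (inj₁ _) c≤𝟘 = cong inj₁ (≤𝟘⇒≡𝟘 c≤𝟘)
  ≤̃𝟘̃⇒≡𝟘̃ (inj₂ (_ , h)) c≤𝟘 = contradiction (≤𝟘⇒≡𝟘 c≤𝟘) (H⇒≢𝟘 h)

  atom≢𝟘̃ : ∀ a → IsAtomL̃ a → a ≢ 𝟘̃
  atom≢𝟘̃ (inj₁ _) aa refl = proj₁ aa refl

  ≤̃-atom : ∀ c a → IsAtomL̃ a → c ≤̃ a → (c ≡ 𝟘̃) ⊎ (c ≡ a)
  ≤̃-atom (inj₁ c) (inj₁ a) aa c≤a with proj₂ aa c c≤a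
  ... | inj₁ refl = inj₁ refl
  ... | inj₂ refl = inj₂ refl
  ≤̃-atom (inj₂ (p , h)) (inj₁ a) aa p≤a with proj₂ aa p p≤a
  ... | inj₁ p≡𝟘 = contradiction p≡𝟘 (H⇒≢𝟘 h)
  ... | inj₂ refl = contradiction aa (H⇒¬atom h)
  ≤̃-atom (inj₁ _) (inj₂ _) _ refl = inj₁ refl
  ≤̃-atom (inj₂ _) (inj₂ _) _ p≡q = inj₂ (w-≡ p≡q)

  atom-≤̃-atom : ∀ c a → IsAtomL̃ c → IsAtomL̃ a → c ≤̃ a → c ≡ a
  atom-≤̃-atom c a ac aa c≤a with ≤̃-atom c a aa c≤a
  ... | inj₁ c≡𝟘 = contradiction c≡𝟘 (atom≢𝟘̃ c ac)
  ... | inj₂ c≡a = c≡a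

  joinIrr-atom : ∀ {p} → IsJoinIrr p → Σ[ c ∈ L̃ ] (IsAtomL̃ c × ⌈ c ⌉ ≡ p)
  joinIrr-atom {p} jp with isAtom? p
  ... | yes ap  = emb p , ap , refl
  ... | no ¬ap = w p (fromWitness (jp , ¬ap)) , tt , refl

  atomistic : ∀ y z → (∀ c → IsAtomL̃ c → c ≤̃ emb y → c ≤̃ z) → emb y ≤̃ z
  atomistic y (inj₁ z) atoms≤z = ≤-byJoinIrr y z λ p jp p≤y →
    let c , ac , ⌈c⌉≡p = joinIrr-atom jp
        c≤y = ⌈⌉≤⇒≤̃emb c (subst (_≤ y) (sym ⌈c⌉≡p) p≤y)
    in subst (_≤ z) ⌈c⌉≡p (≤̃emb⇒⌈⌉≤ c (atoms≤z c ac c≤y))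
  atomistic y (inj₂ (q , hq)) atoms≤wq =
    ≤𝟘⇒≡𝟘 (joinIrrs-≡-nonAtom⇒≤𝟘 (H⇒≢𝟘 hq) (H⇒¬atom hq) λ p jp p≤y →
      let c , ac , ⌈c⌉≡p = joinIrr-atom jp
          c≤y = ⌈⌉≤⇒≤̃emb c (subst (_≤ y) (sym ⌈c⌉≡p) p≤y)
      in trans (sym ⌈c⌉≡p) (cong ⌈_⌉ (atom-≤̃-atom c (w q hq) ac tt (atoms≤wq c ac c≤y))))

  C-≡ : ∀ {u v : C} → proj₁ u ≡ proj₁ v → u ≡ v
  C-≡ {c , _} {_ , _} refl = cong (c ,_) (T-irrelevant _ _)

  classify : (u : C) → InC (proj₁ u)
  classify u = toWitness {a? = inC? (proj₁ u)} (proj₂ u)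

  atomC : ∀ a → IsAtomL̃ a → C
  atomC a aa = a , fromWitness {a? = inC? a} (inj₂ (inj₂ aa))

  0C : C
  0C = 𝟘̃ , fromWitness {a? = inC? 𝟘̃} (inj₁ refl)

  ≤C-trans : ∀ u v t → u ≤C v → v ≤C t → u ≤C t
  ≤C-trans u v t = ≤̃-trans (proj₁ u) (proj₁ v) (proj₁ t)

  ≤C-nonTop : ∀ u v → u ≤C v → proj₁ v ≢ 𝟙̃ → (proj₁ u ≡ 𝟘̃) ⊎ (u ≡ v)
  ≤C-nonTop u v u≤v v≢𝟙 with classify v
  ... | inj₁ v≡𝟘         = inj₁ (≤̃𝟘̃⇒≡𝟘̃ (proj₁ u) (subst (proj₁ u ≤̃_) v≡𝟘 u≤v))
  ... | inj₂ (inj₁ v≡𝟙)  = contradiction v≡𝟙 v≢𝟙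
  ... | inj₂ (inj₂ av)   = Sum.map₂ C-≡ (≤̃-atom (proj₁ u) (proj₁ v) av u≤v)

  NonZeroSquare : (C → C → C) → Pred C 0ℓ
  NonZeroSquare T u = proj₁ (T u u) ≢ 𝟘̃

  -- Below 1 the elements of C(L̃) are 0 and pairwise incomparable atoms, so a decreasing
  -- commutative operation with unit 1 is automatically monotone and associative.
  module DecreasingOp (T : C → C → C) (comm : ∀ u v → T u v ≡ T v u)
                      (identityʳ : ∀ u → T u 𝟙C ≡ u) (≤ˡ : ∀ u v → T u v ≤C u) where

    ≤ʳ : ∀ u v → T u v ≤C v
    ≤ʳ u v = subst (λ t → proj₁ t ≤̃ proj₁ v) (comm v u) (≤ˡ v u)

    topˡ : ∀ {u} v → proj₁ u ≡ 𝟙̃ → T u v ≡ v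
    topˡ v u≡𝟙 = trans (cong (λ t → T t v) (C-≡ u≡𝟙)) (trans (comm 𝟙C v) (identityʳ v))

    topʳ : ∀ u {v} → proj₁ v ≡ 𝟙̃ → T u v ≡ u
    topʳ u {v} v≡𝟙 = trans (comm u v) (topˡ u v≡𝟙)

    zeroˡ : ∀ {u} v → proj₁ u ≡ 𝟘̃ → T u v ≡ 0C
    zeroˡ {u} v u≡𝟘 = C-≡ (≤̃𝟘̃⇒≡𝟘̃ _ (subst (proj₁ (T u v) ≤̃_) u≡𝟘 (≤ˡ u v)))

    zeroʳ : ∀ u {v} → proj₁ v ≡ 𝟘̃ → T u v ≡ 0C
    zeroʳ u {v} v≡𝟘 = trans (comm u v) (zeroˡ u v≡𝟘)

    zero-or-idempotent : ∀ {u v} → proj₁ u ≢ 𝟙̃ → proj₁ v ≢ 𝟙̃ → (T u v ≡ 0C) ⊎ (u ≡ v × T u v ≡ u)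
    zero-or-idempotent {u} {v} u≢𝟙 v≢𝟙 = below-u (≤C-nonTop (T u v) u (≤ˡ u v) u≢𝟙)
      where
      below-u : (proj₁ (T u v) ≡ 𝟘̃) ⊎ (T u v ≡ u) → (T u v ≡ 0C) ⊎ (u ≡ v × T u v ≡ u)
      below-u (inj₁ uv≡𝟘) = inj₁ (C-≡ uv≡𝟘)
      below-u (inj₂ uv≡u) with ≤C-nonTop u v (subst (_≤C v) uv≡u (≤ʳ u v)) v≢𝟙
      ... | inj₁ u≡𝟘 = inj₁ (zeroˡ v u≡𝟘)
      ... | inj₂ u≡v = inj₂ (u≡v , uv≡u)

    nonZeroSquare⇒idempotent : ∀ u → NonZeroSquare T u → T u u ≡ u
    nonZeroSquare⇒idempotent u uu≢𝟘 = by-top (proj₁ u ≟̃ 𝟙̃)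
      where
      by-top : Dec (proj₁ u ≡ 𝟙̃) → T u u ≡ u
      by-top (yes u≡𝟙) = topˡ u u≡𝟙
      by-top (no u≢𝟙) with zero-or-idempotent u≢𝟙 u≢𝟙
      ... | inj₁ uu≡𝟘       = contradiction (cong proj₁ uu≡𝟘) uu≢𝟘
      ... | inj₂ (_ , uu≡u) = uu≡u

    mono : ∀ {u u′ v v′} → u ≤C u′ → v ≤C v′ → T u v ≤C T u′ v′
    mono {u} {u′} {v} {v′} u≤u′ v≤v′ = by-top (proj₁ u′ ≟̃ 𝟙̃) (proj₁ v′ ≟̃ 𝟙̃)
      where
      by-bottom : (proj₁ u ≡ 𝟘̃) ⊎ (u ≡ u′) → (proj₁ v ≡ 𝟘̃) ⊎ (v ≡ v′) → T u v ≤C T u′ v′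
      by-bottom (inj₁ u≡𝟘) _ =
        subst (_≤C T u′ v′) (sym (zeroˡ v u≡𝟘)) (𝟘̃-minimum (proj₁ (T u′ v′)))
      by-bottom (inj₂ _) (inj₁ v≡𝟘) =
        subst (_≤C T u′ v′) (sym (zeroʳ u v≡𝟘)) (𝟘̃-minimum (proj₁ (T u′ v′)))
      by-bottom (inj₂ u≡u′) (inj₂ v≡v′) =
        subst (T u v ≤C_) (cong₂ T u≡u′ v≡v′) (≤̃-refl (proj₁ (T u v)))
      by-top : Dec (proj₁ u′ ≡ 𝟙̃) → Dec (proj₁ v′ ≡ 𝟙̃) → T u v ≤C T u′ v′
      by-top (yes u′≡𝟙) _ =
        subst (T u v ≤C_) (sym (topˡ v′ u′≡𝟙)) (≤C-trans (T u v) v v′ (≤ʳ u v) v≤v′)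
      by-top (no _) (yes v′≡𝟙) =
        subst (T u v ≤C_) (sym (topʳ u′ v′≡𝟙)) (≤C-trans (T u v) u u′ (≤ˡ u v) u≤u′)
      by-top (no u′≢𝟙) (no v′≢𝟙) = by-bottom (≤C-nonTop u u′ u≤u′ u′≢𝟙) (≤C-nonTop v v′ v≤v′ v′≢𝟙)

    assoc-nonTop : ∀ {x y z} → (T x y ≡ 0C) ⊎ (x ≡ y × T x y ≡ x) → (T y z ≡ 0C) ⊎ (y ≡ z × T y z ≡ y) →
                   T (T x y) z ≡ T x (T y z)
    assoc-nonTop {x} {y} {z} (inj₁ xy≡0) (inj₁ yz≡0) =
      trans (cong (λ t → T t z) xy≡0) (trans (zeroˡ z refl) (sym (trans (cong (T x) yz≡0) (zeroʳ x refl))))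
    assoc-nonTop {x} {y} (inj₁ xy≡0) (inj₂ (refl , yy≡y)) =
      trans (cong (λ t → T t y) xy≡0) (trans (zeroˡ y refl) (sym (trans (cong (T x) yy≡y) xy≡0)))
    assoc-nonTop {x} {_} {z} (inj₂ (refl , xx≡x)) (inj₁ xz≡0) =
      trans (cong (λ t → T t z) xx≡x) (trans xz≡0 (sym (trans (cong (T x) xz≡0) (zeroʳ x refl))))
    assoc-nonTop {x} (inj₂ (refl , xx≡x)) (inj₂ (refl , _)) =
      trans (cong (λ t → T t x) xx≡x) (cong (T x) (sym xx≡x))

    assoc : ∀ x y z → T (T x y) z ≡ T x (T y z)
    assoc x y z = by-top (proj₁ x ≟̃ 𝟙̃) (proj₁ y ≟̃ 𝟙̃) (proj₁ z ≟̃ 𝟙̃)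
      where
      by-top : Dec (proj₁ x ≡ 𝟙̃) → Dec (proj₁ y ≡ 𝟙̃) → Dec (proj₁ z ≡ 𝟙̃) → T (T x y) z ≡ T x (T y z)
      by-top (yes x≡𝟙) _ _ =
        trans (cong (λ t → T t z) (topˡ y x≡𝟙)) (sym (topˡ (T y z) x≡𝟙))
      by-top (no _) (yes y≡𝟙) _ =
        trans (cong (λ t → T t z) (topʳ x y≡𝟙)) (cong (T x) (sym (topˡ z y≡𝟙)))
      by-top (no _) (no _) (yes z≡𝟙) =
        trans (topʳ (T x y) z≡𝟙) (cong (T x) (sym (topʳ y z≡𝟙)))
      by-top (no x≢𝟙) (no y≢𝟙) (no z≢𝟙) =
        assoc-nonTop (zero-or-idempotent x≢𝟙 y≢𝟙) (zero-or-idempotent y≢𝟙 z≢𝟙)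

    isTNorm : IsTNormC L T
    isTNorm = record { mono = mono ; comm = comm ; assoc = assoc ; identityʳ = identityʳ }

  tnorm-≤ˡ : ∀ {T} → IsTNormC L T → ∀ u v → T u v ≤C u
  tnorm-≤ˡ {T} isT u v = subst (λ t → proj₁ (T u v) ≤̃ proj₁ t) (identityʳ u)
    (mono {u} {u} {v} {𝟙C} (≤̃-refl (proj₁ u)) (𝟙̃-maximum (proj₁ v)))
    where open IsTNorm isT

  module TNormC {T} (isT : IsTNormC L T) =
    DecreasingOp T (IsTNorm.comm isT) (IsTNorm.identityʳ isT) (tnorm-≤ˡ isT)

  -- The atoms of L̃ correspond to J(L): an atom a of L to itself, p ∈ H(L) to w_p.
  AtAtom : ∀ {ℓ} → Pred C ℓ → Pred (Fin n) ℓ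
  AtAtom P a = (Σ[ aa ∈ IsAtom a ] P (atomC (emb a) aa)) ⊎ (Σ[ h ∈ True (isH? a) ] P (atomC (w a h) tt))

  module _ {ℓ} {P : Pred C ℓ} where

    atAtom-intro : ∀ u → IsAtomL̃ (proj₁ u) → P u → AtAtom P ⌈ proj₁ u ⌉
    atAtom-intro (inj₁ _ , _) aa pu = inj₁ (aa , subst P (C-≡ refl) pu)
    atAtom-intro (inj₂ (_ , h) , _) _ pu = inj₂ (h , subst P (C-≡ refl) pu)

    atAtom-elim : ∀ {a} → AtAtom P a → Σ[ u ∈ C ] (IsAtomL̃ (proj₁ u) × ⌈ proj₁ u ⌉ ≡ a × P u)
    atAtom-elim {a} (inj₁ (aa , pu)) = atomC (emb a) aa , aa , refl , pu
    atAtom-elim {a} (inj₂ (h , pu))  = atomC (w a h) tt , tt , refl , pu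

    atAtom-map : ∀ {ℓ′} {Q : Pred C ℓ′} {a} →
                 (∀ u → IsAtomL̃ (proj₁ u) → ⌈ proj₁ u ⌉ ≡ a → P u → Q u) → AtAtom P a → AtAtom Q a
    atAtom-map P⇒Q = Sum.map (λ (aa , pu) → aa , P⇒Q _ aa refl pu) (λ (h , pu) → h , P⇒Q _ tt refl pu)

    atAtom? : Decidable P → Decidable (AtAtom P)
    atAtom? P? a =
      Σ-dec (isAtom? a) (subst P (C-≡ refl)) (λ aa → P? (atomC (emb a) aa)) ⊎-dec
      Σ-dec (T? _) (subst P (C-≡ (w-≡ refl))) (λ h → P? (atomC (w a h) tt))

  atAtom-∪⁻ : ∀ {ℓ ℓ′} {P : Pred C ℓ} {Q : Pred C ℓ′} {a} →
              AtAtom (λ u → P u ⊎ Q u) a → AtAtom P a ⊎ AtAtom Q a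
  atAtom-∪⁻ (inj₁ (aa , inj₁ pu)) = inj₁ (inj₁ (aa , pu))
  atAtom-∪⁻ (inj₁ (aa , inj₂ qu)) = inj₂ (inj₁ (aa , qu))
  atAtom-∪⁻ (inj₂ (h , inj₁ pu))  = inj₁ (inj₂ (h , pu))
  atAtom-∪⁻ (inj₂ (h , inj₂ qu))  = inj₂ (inj₂ (h , qu))

  Generator : (C → C → C) → Pred (Fin n) 0ℓ
  Generator T = AtAtom (NonZeroSquare T)

  generator? : ∀ T → Decidable (Generator T)
  generator? T = atAtom? λ u → ¬? (proj₁ (T u u) ≟̃ 𝟘̃)

  atom⇒𝟙̃≢𝟘̃ : ∀ c → IsAtomL̃ c → 𝟙̃ ≢ 𝟘̃
  atom⇒𝟙̃≢𝟘̃ c ac 𝟙≡𝟘 = atom≢𝟘̃ c ac (≤̃𝟘̃⇒≡𝟘̃ c (subst (c ≤̃_) 𝟙≡𝟘 (𝟙̃-maximum c)))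

  barValue-unique : ∀ {T x y a b} → IsBarValue T x y (emb a) → IsBarValue T x y (emb b) → a ≡ b
  barValue-unique (a-ub , a-least) (b-ub , b-least) = antisym (a-least _ b-ub) (b-least _ a-ub)

  module Restriction {T} (isT : IsTNormC L T) where
    open TNormC isT
    open IsTNorm isT using (comm)

    UpperBound : Fin n → Fin n → L̃ → Set
    UpperBound x y z = ∀ u v → InKappa (emb x) u → InKappa (emb y) v → proj₁ (T u v) ≤̃ z

    barValue-swap : ∀ {x y z} → IsBarValue T (emb x) (emb y) z → IsBarValue T (emb y) (emb x) z
    barValue-swap {z = z} (ub , least) = swap ub , λ z′ ub′ → least z′ (swap ub′)
      where
      swap : ∀ {x y z} → UpperBound x y z → UpperBound y x z
      swap {z = z} ub u v ku kv = subst (λ t → proj₁ t ≤̃ z) (comm v u) (ub v u kv ku)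

    barValue-𝟙ˡ : ∀ y → IsBarValue T (emb 𝟙) (emb y) (emb y)
    barValue-𝟙ˡ y = (λ u v _ kv → ≤̃-trans (proj₁ (T u v)) (proj₁ v) (emb y) (≤ʳ u v) (proj₂ kv))
                  , λ z ub → atomistic y z λ c ac c≤y →
                      subst (λ t → proj₁ t ≤̃ z) (topˡ (atomC c ac) refl)
                        (ub 𝟙C (atomC c ac) (atom⇒𝟙̃≢𝟘̃ c ac , ≤̃-refl 𝟙̃) (atom≢𝟘̃ c ac , c≤y))

    kappa-nonTop : ∀ {x} u → x ≢ 𝟙 → InKappa (emb x) u → proj₁ u ≢ 𝟙̃
    kappa-nonTop u x≢𝟙 (_ , u≤x) u≡𝟙 = x≢𝟙 (antisym (maximum _) (subst (_≤̃ emb _) u≡𝟙 u≤x))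

    kappa-atom : ∀ {x} u → x ≢ 𝟙 → InKappa (emb x) u → IsAtomL̃ (proj₁ u)
    kappa-atom u x≢𝟙 ku with classify u
    ... | inj₁ u≡𝟘         = contradiction u≡𝟘 (proj₁ ku)
    ... | inj₂ (inj₁ u≡𝟙)  = contradiction u≡𝟙 (kappa-nonTop u x≢𝟙 ku)
    ... | inj₂ (inj₂ au)   = au

    G? : Decidable (Generator T)
    G? = generator? T

    upperBound-intro : ∀ {x y z} → x ≢ 𝟙 → y ≢ 𝟙 →
      (∀ u → IsAtomL̃ (proj₁ u) → NonZeroSquare T u → ⌈ proj₁ u ⌉ ≤ (x ∧ y) → proj₁ u ≤̃ z) →
      UpperBound x y z
    upperBound-intro {x} {y} {z} x≢𝟙 y≢𝟙 idempotents≤z u v ku kv = by-zero (proj₁ (T u v) ≟̃ 𝟘̃)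
      where
      by-zero : Dec (proj₁ (T u v) ≡ 𝟘̃) → proj₁ (T u v) ≤̃ z
      by-zero (yes uv≡𝟘) = subst (_≤̃ z) (sym uv≡𝟘) (𝟘̃-minimum z)
      by-zero (no uv≢𝟘) with zero-or-idempotent (kappa-nonTop u x≢𝟙 ku) (kappa-nonTop v y≢𝟙 kv)
      ... | inj₁ uv≡0 = contradiction (cong proj₁ uv≡0) uv≢𝟘
      ... | inj₂ (u≡v , uv≡u) = subst (λ t → proj₁ t ≤̃ z) (sym uv≡u)
        (idempotents≤z u (kappa-atom u x≢𝟙 ku) (subst (λ t → proj₁ (T u t) ≢ 𝟘̃) (sym u≡v) uv≢𝟘)
          (∧-greatest (≤̃emb⇒⌈⌉≤ (proj₁ u) (proj₂ ku))
                      (≤̃emb⇒⌈⌉≤ (proj₁ u) (proj₂ (subst (InKappa (emb y)) (sym u≡v) kv)))))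

    ≤-upperBound : ∀ {x y z} → UpperBound x y z →
                   ∀ u → NonZeroSquare T u → proj₁ u ≤̃ emb (x ∧ y) → proj₁ u ≤̃ z
    ≤-upperBound {x} {y} {z} ub u uu≢𝟘 u≤x∧y =
      subst (λ t → proj₁ t ≤̃ z) (nonZeroSquare⇒idempotent u uu≢𝟘) (ub u u (u≢𝟘 , u≤x) (u≢𝟘 , u≤y))
      where
      u≢𝟘 : proj₁ u ≢ 𝟘̃
      u≢𝟘 u≡𝟘 = uu≢𝟘 (cong proj₁ (zeroˡ u u≡𝟘))
      u≤x = ≤̃-trans (proj₁ u) (emb (x ∧ y)) (emb x) u≤x∧y (x∧y≤x x y)
      u≤y = ≤̃-trans (proj₁ u) (emb (x ∧ y)) (emb y) u≤x∧y (x∧y≤y x y)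

    no-idempotent-below : CondC T → ∀ {x y q hq} → x ≢ 𝟙 → UpperBound x y (w q hq) →
      ∀ u → IsAtomL̃ (proj₁ u) → NonZeroSquare T u → proj₁ u ≤̃ emb (x ∧ y) → ⊥
    no-idempotent-below cond {x} {y} {q} {hq} x≢𝟙 ub u au uu≢𝟘 u≤x∧y =
      let u′ , au′ , u′≤q , u′≢wq , u′u′≢𝟘 = cond q hq q≢𝟙 (subst (NonZeroSquare T) (C-≡ u≡wq) uu≢𝟘)
          u′≤x∧y = ≤̃-trans (proj₁ u′) (emb q) (emb (x ∧ y)) u′≤q q≤x∧y
      in u′≢wq (atom-≤̃-atom (proj₁ u′) (w q hq) au′ tt (≤-upperBound ub u′ u′u′≢𝟘 u′≤x∧y))
      where
      u≡wq : proj₁ u ≡ w q hq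
      u≡wq = atom-≤̃-atom (proj₁ u) (w q hq) au tt (≤-upperBound ub u uu≢𝟘 u≤x∧y)
      q≤x∧y : q ≤ (x ∧ y)
      q≤x∧y = subst (λ c → ⌈ c ⌉ ≤ (x ∧ y)) u≡wq (≤̃emb⇒⌈⌉≤ (proj₁ u) u≤x∧y)
      q≢𝟙 : q ≢ 𝟙
      q≢𝟙 = ≤-≢𝟙 (≤-trans q≤x∧y (x∧y≤x x y)) x≢𝟙

    barValue-≢𝟙 : CondC T → ∀ {x y} → x ≢ 𝟙 → y ≢ 𝟙 →
                  IsBarValue T (emb x) (emb y) (emb (joinBelow G? (x ∧ y)))
    barValue-≢𝟙 cond {x} {y} x≢𝟙 y≢𝟙 =
      upperBound-intro x≢𝟙 y≢𝟙 (λ u au uu≢𝟘 u≤x∧y →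
        ⌈⌉≤⇒≤̃emb (proj₁ u) (≤-joinBelow G? (atAtom-intro {P = NonZeroSquare T} u au uu≢𝟘) u≤x∧y)) , least
      where
      least : ∀ z → UpperBound x y z → emb (joinBelow G? (x ∧ y)) ≤̃ z
      least (inj₁ z) ub = joinBelow-least G? λ a ga a≤x∧y →
        let u , au , ⌈u⌉≡a , uu≢𝟘 = atAtom-elim {P = NonZeroSquare T} ga
            u≤x∧y = ⌈⌉≤⇒≤̃emb (proj₁ u) (subst (_≤ (x ∧ y)) (sym ⌈u⌉≡a) a≤x∧y)
        in subst (_≤ z) ⌈u⌉≡a (≤̃emb⇒⌈⌉≤ (proj₁ u) (≤-upperBound ub u uu≢𝟘 u≤x∧y))
      least (inj₂ _) ub = ≤𝟘⇒≡𝟘 (joinBelow-least G? λ a ga a≤x∧y →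
        let u , au , ⌈u⌉≡a , uu≢𝟘 = atAtom-elim {P = NonZeroSquare T} ga
            u≤x∧y = ⌈⌉≤⇒≤̃emb (proj₁ u) (subst (_≤ (x ∧ y)) (sym ⌈u⌉≡a) a≤x∧y)
        in ⊥-elim (no-idempotent-below cond x≢𝟙 ub u au uu≢𝟘 u≤x∧y))

    restriction : CondC T → RestrictsTo T (tnormOf G?)
    restriction cond x y with x ≟ 𝟙 | y ≟ 𝟙
    ... | yes refl | _ =
      subst (IsBarValue T (emb 𝟙) (emb y) ∘ emb) (sym (tnormOf-𝟙ˡ G? y)) (barValue-𝟙ˡ y)
    ... | no _ | yes refl =
      subst (IsBarValue T (emb x) (emb 𝟙) ∘ emb) (sym (tnormOf-𝟙ʳ G? x)) (barValue-swap (barValue-𝟙ˡ x))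
    ... | no x≢𝟙 | no y≢𝟙 =
      subst (IsBarValue T (emb x) (emb y) ∘ emb) (sym (tnormOf-≢𝟙 G? x≢𝟙 y≢𝟙)) (barValue-≢𝟙 cond x≢𝟙 y≢𝟙)

  restriction-isTNorm : ∀ T → IsTNormC L T → CondC T →
                        Σ[ f ∈ (Fin n → Fin n → Fin n) ] (RestrictsTo T f × IsTNormL L f)
  restriction-isTNorm T isT cond =
    tnormOf (generator? T) , Restriction.restriction isT cond , tnormOf-isTNorm (generator? T)

  -- t-norms on C(L̃) with prescribed idempotent atoms

  -- Condition (C) for the atoms satisfying P; CondC T unfolds to ConditionC (NonZeroSquare T).
  ConditionC : ∀ {ℓ} → Pred C ℓ → Set ℓ
  ConditionC P = ∀ p h → p ≢ 𝟙 → P (atomC (w p h) tt) →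
    Σ[ u ∈ C ] (IsAtomL̃ (proj₁ u) × proj₁ u ≤̃ emb p × proj₁ u ≢ w p h × P u)

  conditionC-descent : ∀ {ℓ} {P : Pred C ℓ} → ConditionC P → ∀ p h → p ≢ 𝟙 → P (atomC (w p h) tt) →
                       ∃ λ b → Σ[ ab ∈ IsAtom b ] (b ≤ p × P (atomC (emb b) ab))
  conditionC-descent {P = P} condP = All.wfRec <-wellFounded _ Descends step
    where
    Descends : Fin n → Set _
    Descends p = ∀ h → p ≢ 𝟙 → P (atomC (w p h) tt) →
                 ∃ λ b → Σ[ ab ∈ IsAtom b ] (b ≤ p × P (atomC (emb b) ab))
    step : ∀ p → WfRec _<_ Descends p → Descends p
    step p rec h p≢𝟙 Pwp with condP p h p≢𝟙 Pwp
    ... | (inj₁ b , _) , ab , b≤p , _ , Pb = b , ab , b≤p , subst P (C-≡ refl) Pb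
    ... | (inj₂ (q , hq) , _) , _ , q≤p , wq≢wp , Pwq =
      let b , ab , b≤q , Pb = rec (q≤p , wq≢wp ∘ w-≡) hq (≤-≢𝟙 q≤p p≢𝟙) (subst P (C-≡ refl) Pwq)
      in b , ab , ≤-trans b≤q q≤p , Pb

  module _ {ℓ} {E : Pred C ℓ} (E? : Decidable E) where

    select : ∀ u v → Dec (proj₁ u ≡ 𝟙̃) → Dec (proj₁ v ≡ 𝟙̃) → Dec (proj₁ u ≡ proj₁ v × E u) → C
    select u v (yes _) _       _       = v
    select u v (no _)  (yes _) _       = u
    select u v (no _)  (no _)  (yes _) = u
    select u v (no _)  (no _)  (no _)  = 0C

    select-comm : ∀ u v d₁ d₂ d₃ d₃′ → select u v d₁ d₂ d₃ ≡ select v u d₂ d₁ d₃′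
    select-comm u v (yes u≡𝟙) (yes v≡𝟙) _ _ = C-≡ (trans v≡𝟙 (sym u≡𝟙))
    select-comm u v (yes _) (no _) _ _ = refl
    select-comm u v (no _) (yes _) _ _ = refl
    select-comm u v (no _) (no _) (yes (u≡v , _)) (yes _) = C-≡ u≡v
    select-comm u v (no _) (no _) (yes (u≡v , Eu)) (no ¬v≡u×Ev) =
      contradiction (sym u≡v , subst E (C-≡ u≡v) Eu) ¬v≡u×Ev
    select-comm u v (no _) (no _) (no ¬u≡v×Eu) (yes (v≡u , Ev)) =
      contradiction (sym v≡u , subst E (C-≡ v≡u) Ev) ¬u≡v×Eu
    select-comm u v (no _) (no _) (no _) (no _) = refl

    select-𝟙ʳ : ∀ u d₁ d₂ d₃ → select u 𝟙C d₁ d₂ d₃ ≡ u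
    select-𝟙ʳ u (yes u≡𝟙) _ _ = C-≡ (sym u≡𝟙)
    select-𝟙ʳ u (no _) (yes _) _ = refl
    select-𝟙ʳ u (no _) (no 𝟙≢𝟙) _ = contradiction refl 𝟙≢𝟙

    select-≤ˡ : ∀ u v d₁ d₂ d₃ → select u v d₁ d₂ d₃ ≤C u
    select-≤ˡ u v (yes u≡𝟙) _ _ = subst (proj₁ v ≤̃_) (sym u≡𝟙) (𝟙̃-maximum (proj₁ v))
    select-≤ˡ u v (no _) (yes _) _ = ≤̃-refl (proj₁ u)
    select-≤ˡ u v (no _) (no _) (yes _) = ≤̃-refl (proj₁ u)
    select-≤ˡ u v (no _) (no _) (no _) = 𝟘̃-minimum (proj₁ u)

    select-diag⇒E : ∀ u d₁ d₃ → proj₁ u ≢ 𝟙̃ → proj₁ (select u u d₁ d₁ d₃) ≢ 𝟘̃ → E u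
    select-diag⇒E u (yes u≡𝟙) _ u≢𝟙 _ = contradiction u≡𝟙 u≢𝟙
    select-diag⇒E u (no _) (yes (_ , Eu)) _ _ = Eu
    select-diag⇒E u (no _) (no _) _ 𝟘≢𝟘 = contradiction refl 𝟘≢𝟘

    E⇒select-diag : ∀ u d₁ d₃ → proj₁ u ≢ 𝟘̃ → E u → proj₁ (select u u d₁ d₁ d₃) ≢ 𝟘̃
    E⇒select-diag u (yes _) _ u≢𝟘 _ = u≢𝟘
    E⇒select-diag u (no _) (yes _) u≢𝟘 _ = u≢𝟘
    E⇒select-diag u (no _) (no ¬u≡u×Eu) _ Eu = contradiction (refl , Eu) ¬u≡u×Eu

    top? : ∀ (u : C) → Dec (proj₁ u ≡ 𝟙̃)
    top? u = proj₁ u ≟̃ 𝟙̃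

    idempotentPair? : ∀ (u v : C) → Dec (proj₁ u ≡ proj₁ v × E u)
    idempotentPair? u v = proj₁ u ≟̃ proj₁ v ×-dec E? u

    -- the t-norm on C(L̃) whose idempotent atoms are exactly the atoms satisfying E
    idemTNorm : C → C → C
    idemTNorm u v = select u v (top? u) (top? v) (idempotentPair? u v)

    idemTNorm-isTNorm : IsTNormC L idemTNorm
    idemTNorm-isTNorm = DecreasingOp.isTNorm idemTNorm
      (λ u v → select-comm u v (top? u) (top? v) (idempotentPair? u v) (idempotentPair? v u))
      (λ u → select-𝟙ʳ u (top? u) (top? 𝟙C) (idempotentPair? u 𝟙C))
      (λ u v → select-≤ˡ u v (top? u) (top? v) (idempotentPair? u v))

    idemTNorm-nonZeroSquare⇒E : ∀ u → proj₁ u ≢ 𝟙̃ → NonZeroSquare idemTNorm u → E u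
    idemTNorm-nonZeroSquare⇒E u = select-diag⇒E u (top? u) (idempotentPair? u u)

    E⇒idemTNorm-nonZeroSquare : ∀ u → IsAtomL̃ (proj₁ u) → E u → NonZeroSquare idemTNorm u
    E⇒idemTNorm-nonZeroSquare u au = E⇒select-diag u (top? u) (idempotentPair? u u) (atom≢𝟘̃ (proj₁ u) au)

    generator-idemTNorm⁻ : ∀ {a} → a ≢ 𝟙 → Generator idemTNorm a → AtAtom E a
    generator-idemTNorm⁻ a≢𝟙 = atAtom-map λ u _ ⌈u⌉≡a →
      idemTNorm-nonZeroSquare⇒E u λ u≡𝟙 → a≢𝟙 (trans (sym ⌈u⌉≡a) (cong ⌈_⌉ u≡𝟙))

    generator-idemTNorm⁺ : ∀ {a} → AtAtom E a → Generator idemTNorm a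
    generator-idemTNorm⁺ = atAtom-map λ u au _ → E⇒idemTNorm-nonZeroSquare u au

    idemTNorm-condC : ConditionC E → CondC idemTNorm
    idemTNorm-condC condE p h p≢𝟙 wpwp≢𝟘 =
      let u , au , u≤p , u≢wp , Eu = condE p h p≢𝟙 (idemTNorm-nonZeroSquare⇒E _ (λ ()) wpwp≢𝟘)
      in u , au , u≤p , u≢wp , E⇒idemTNorm-nonZeroSquare u au Eu

  -- Joins and meets in 𝒮

  tnormOf-InS : ∀ {T} → IsTNormC L T → CondC T → InS L (tnormOf (generator? T))
  tnormOf-InS {T} isT cond = T , isT , cond , Restriction.restriction isT cond

  InS⇒≡tnormOf : ∀ {f} (s : InS L f) → ∀ x y → f x y ≡ tnormOf (generator? (proj₁ s)) x y
  InS⇒≡tnormOf (T , isT , cond , restricts) x y =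
    barValue-unique {T} (restricts x y) (Restriction.restriction isT cond x y)

  generator⇒≤diag : ∀ {f} (s : InS L f) {a} → a ≢ 𝟙 → Generator (proj₁ s) a → a ≤ f a a
  generator⇒≤diag s {a} a≢𝟙 ga = subst (a ≤_) (sym (InS⇒≡tnormOf s a a)) (≤-tnormOf-diag _ ga a≢𝟙)

  InS-diag-≤ : ∀ {f} (s : InS L f) a → f a a ≤ a
  InS-diag-≤ s a = subst (_≤ a) (sym (InS⇒≡tnormOf s a a)) (tnormOf-≤ˡ _ a a)

  InS-≤ : ∀ {f f′} (s : InS L f) (s′ : InS L f′) →
          (∀ a → a ≢ 𝟙 → Generator (proj₁ s) a → a ≤ f′ a a) → ∀ x y → f x y ≤ f′ x y
  InS-≤ s s′ G≤diag x y = subst₂ _≤_ (sym (InS⇒≡tnormOf s x y)) (sym (InS⇒≡tnormOf s′ x y))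
    (tnormOf-≤ _ _ (λ a a≢𝟙 ga → subst (a ≤_) (InS⇒≡tnormOf s′ a a) (G≤diag a a≢𝟙 ga)) x y)

  joinInS : ∀ f g → InS L f → InS L g → Σ[ h ∈ (Fin n → Fin n → Fin n) ] IsJoinInS L f g h
  joinInS f g sf@(T₁ , _ , cond₁ , _) sg@(T₂ , _ , cond₂ , _) =
    tnormOf (generator? T₃) , sh ,
    InS-≤ sf sh (λ a a≢𝟙 → generator⇒≤diag sh a≢𝟙 ∘ from₁) ,
    InS-≤ sg sh (λ a a≢𝟙 → generator⇒≤diag sh a≢𝟙 ∘ from₂) ,
    least
    where
    Either : Pred C 0ℓ
    Either u = NonZeroSquare T₁ u ⊎ NonZeroSquare T₂ u
    either? : Decidable Either
    either? u = ¬? (proj₁ (T₁ u u) ≟̃ 𝟘̃) ⊎-dec ¬? (proj₁ (T₂ u u) ≟̃ 𝟘̃)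
    condEither : ConditionC Either
    condEither p h p≢𝟙 (inj₁ nz) =
      let u , au , u≤p , u≢wp , nz′ = cond₁ p h p≢𝟙 nz in u , au , u≤p , u≢wp , inj₁ nz′
    condEither p h p≢𝟙 (inj₂ nz) =
      let u , au , u≤p , u≢wp , nz′ = cond₂ p h p≢𝟙 nz in u , au , u≤p , u≢wp , inj₂ nz′
    T₃ : C → C → C
    T₃ = idemTNorm either?
    sh : InS L (tnormOf (generator? T₃))
    sh = tnormOf-InS (idemTNorm-isTNorm either?) (idemTNorm-condC either? condEither)
    from₁ : ∀ {a} → Generator T₁ a → Generator T₃ a
    from₁ = generator-idemTNorm⁺ either? ∘ atAtom-map {P = NonZeroSquare T₁} {Q = Either} (λ _ _ _ → inj₁)
    from₂ : ∀ {a} → Generator T₂ a → Generator T₃ a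
    from₂ = generator-idemTNorm⁺ either? ∘ atAtom-map {P = NonZeroSquare T₂} {Q = Either} (λ _ _ _ → inj₂)
    least : ∀ k → InS L k → (∀ x y → f x y ≤ k x y) → (∀ x y → g x y ≤ k x y) →
            ∀ x y → tnormOf (generator? T₃) x y ≤ k x y
    least k sk f≤k g≤k = InS-≤ sh sk λ a a≢𝟙 g₃ →
      Sum.[_,_]′ (λ g₁ → ≤-trans (generator⇒≤diag sf a≢𝟙 g₁) (f≤k a a))
                 (λ g₂ → ≤-trans (generator⇒≤diag sg a≢𝟙 g₂) (g≤k a a))
        (atAtom-∪⁻ {P = NonZeroSquare T₁} {Q = NonZeroSquare T₂} (generator-idemTNorm⁻ either? a≢𝟙 g₃))

  meetInS : ∀ f g → InS L f → InS L g → Σ[ h ∈ (Fin n → Fin n → Fin n) ] IsMeetInS L f g h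
  meetInS f g sf sg =
    tnormOf (generator? T*) , sh ,
    InS-≤ sh sf (λ a a≢𝟙 g* → reflexive (sym (proj₁ (generator*⇒good a≢𝟙 g*)))) ,
    InS-≤ sh sg (λ a a≢𝟙 g* → reflexive (sym (proj₂ (generator*⇒good a≢𝟙 g*)))) ,
    greatest
    where
    Good : Pred (Fin n) 0ℓ
    Good a = f a a ≡ a × g a a ≡ a
    good? : Decidable Good
    good? a = (f a a ≟ a) ×-dec (g a a ≟ a)
    -- w_p is kept only above a kept atom of L, so that condition (C) holds.
    Kept : Pred C 0ℓ
    Kept (inj₁ a , _)       = Good a
    Kept (inj₂ (p , _) , _) = Good p × ∃ λ b → IsAtom b × b ≤ p × Good b
    kept? : Decidable Kept
    kept? (inj₁ a , _)       = good? a
    kept? (inj₂ (p , _) , _) = good? p ×-dec any? (λ b → isAtom? b ×-dec ((b ≤? p) ×-dec good? b))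
    kept⇒good : ∀ u → Kept u → Good ⌈ proj₁ u ⌉
    kept⇒good (inj₁ _ , _) ga       = ga
    kept⇒good (inj₂ _ , _) (gp , _) = gp
    condKept : ConditionC Kept
    condKept p h p≢𝟙 (_ , b , ab , b≤p , gb) = atomC (emb b) ab , ab , b≤p , (λ ()) , gb
    T* : C → C → C
    T* = idemTNorm kept?
    sh : InS L (tnormOf (generator? T*))
    sh = tnormOf-InS (idemTNorm-isTNorm kept?) (idemTNorm-condC kept? condKept)
    generator*⇒good : ∀ {a} → a ≢ 𝟙 → Generator T* a → Good a
    generator*⇒good a≢𝟙 g* =
      let u , _ , ⌈u⌉≡a , ku = atAtom-elim {P = Kept} (generator-idemTNorm⁻ kept? a≢𝟙 g*)
      in subst Good ⌈u⌉≡a (kept⇒good u ku)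
    greatest : ∀ k → InS L k → (∀ x y → k x y ≤ f x y) → (∀ x y → k x y ≤ g x y) →
               ∀ x y → k x y ≤ tnormOf (generator? T*) x y
    greatest k sk@(Tk , _ , condk , _) k≤f k≤g = InS-≤ sk sh λ a a≢𝟙 gk →
      generator⇒≤diag sh a≢𝟙 (generator-idemTNorm⁺ kept? (kept-of a≢𝟙 gk))
      where
      good : ∀ {a} → a ≢ 𝟙 → Generator Tk a → Good a
      good {a} a≢𝟙 gk =
        let a≤kaa = generator⇒≤diag sk a≢𝟙 gk
        in antisym (InS-diag-≤ sf a) (≤-trans a≤kaa (k≤f a a))
         , antisym (InS-diag-≤ sg a) (≤-trans a≤kaa (k≤g a a))
      kept-of : ∀ {a} → a ≢ 𝟙 → Generator Tk a → AtAtom Kept a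
      kept-of a≢𝟙 gk@(inj₁ (aa , _)) = inj₁ (aa , good a≢𝟙 gk)
      kept-of {a} a≢𝟙 gk@(inj₂ (h , nz)) =
        let b , ab , b≤a , nzb = conditionC-descent {P = NonZeroSquare Tk} condk a h a≢𝟙 nz
        in inj₂ (h , good a≢𝟙 gk , b , ab , b≤a , good (≤-≢𝟙 b≤a a≢𝟙) (inj₁ (ab , nzb)))

theorem6p9 : ∀ {n : ℕ} (L : FinLattice n) →
  -- 𝒮 ⊆ t-norms on L  (in particular T̄|_L takes values in L)
  ((T : FinLattice.C L → FinLattice.C L → FinLattice.C L) →
     IsTNormC L T → FinLattice.CondC L T →
     Σ[ f ∈ (Fin n → Fin n → Fin n) ] (FinLattice.RestrictsTo L T f × IsTNormL L f))
  -- (𝒮, ≤̇) is a lattice: every two elements have a join and a meet in 𝒮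
  × (∀ f g → InS L f → InS L g →
       Σ[ h ∈ (Fin n → Fin n → Fin n) ] IsJoinInS L f g h)
  × (∀ f g → InS L f → InS L g →
       Σ[ h ∈ (Fin n → Fin n → Fin n) ] IsMeetInS L f g h)
theorem6p9 L = restriction-isTNorm L , joinInS L , meetInS L
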